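{- Let $G$ be a group, let $x\in G\setminus\{1\}$ and let $a,b\in \operatorname{Sol}_G(x)\setminus\{1\}$. Then $a^G$ and $b^G$ are connected in $\Gamma_{sc}(G)$ and $d(a^G,b^G)\le 2$. In particular, if $\operatorname{Sol}(G)\neq\{1\}$, then $\Gamma_{sc}(G)$ is connected and $\operatorname{diam}(\Gamma_{sc}(G))\le 2$.
   Context: For a group $G$, the SCC-graph $\Gamma_{sc}(G)$ is the simple undirected graph whose vertices are the nontrivial conjugacy classes $x^G=\{gxg^{ -1}:g\in G\}$, $x\ne1$, where two distinct vertices $x^G,y^G$ are adjacent if there exist $x'\in x^G$, $y'\in y^G$ with $\langle x',y'\rangle$ solvable. For $x\in G$, $\operatorname{Sol}_G(x)=\{y\in G: \langle x,y\rangle \text{ is solvable}\}$, and $\operatorname{Sol}(G)=\{x\in G:\langle x,y\rangle\text{ is solvable for all } y\in G\}$. $d(u,v)$ denotes graph distance, with $d(u,u)=0$, and $\operatorname{diam}$ is the maximum distance between vertices. -}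

module Defs where

open import Level using (Level; _⊔_)
open import Algebra.Bundles using (Group)
open import Data.Nat using (ℕ; zero; suc)
open import Data.Product using (Σ; ∃; ∃₂; _×_; _,_)
open import Data.Sum using (_⊎_)
open import Relation.Nullary using (¬_)

module GroupDefs {c ℓ : Level} (G : Group c ℓ) where
  open Group G

  data Gen {p : Level} (P : Carrier → Set p) : Carrier → Set (c ⊔ ℓ ⊔ p) where
    gen  : ∀ {x} → P x → Gen P x
    one  : Gen P ε
    inv  : ∀ {x} → Gen P x → Gen P (x ⁻¹)
    mul  : ∀ {x y} → Gen P x → Gen P y → Gen P (x ∙ y)
    resp : ∀ {x y} → x ≈ y → Gen P x → Gen P y

  comm : Carrier → Carrier → Carrier
  comm a b = a ⁻¹ ∙ b ⁻¹ ∙ a ∙ b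

  Derived : Carrier → Carrier → ℕ → Carrier → Set (c ⊔ ℓ)
  Derived x y zero    = Gen (λ z → (z ≈ x) ⊎ (z ≈ y))
  Derived x y (suc n) =
    Gen (λ z → ∃₂ λ a b → Derived x y n a × Derived x y n b × (z ≈ comm a b))

  SolvablePair : Carrier → Carrier → Set (c ⊔ ℓ)
  SolvablePair x y = ∃ λ n → ∀ z → Derived x y n z → z ≈ ε

  InSolG : Carrier → Carrier → Set (c ⊔ ℓ)
  InSolG x y = SolvablePair x y

  InSol : Carrier → Set (c ⊔ ℓ)
  InSol x = ∀ y → SolvablePair x y

  Conj : Carrier → Carrier → Set (c ⊔ ℓ)
  Conj x y = ∃ λ g → y ≈ g ∙ x ∙ g ⁻¹

  -- adjacency of the (distinct) vertices x^G and y^G in Γ_sc(G)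
  Adj : Carrier → Carrier → Set (c ⊔ ℓ)
  Adj x y = ¬ Conj x y × ∃₂ λ x' y' → Conj x x' × Conj y y' × SolvablePair x' y'

  -- d(a^G , b^G) ≤ 2 in Γ_sc(G) (for nontrivial a, b): the vertices are
  -- equal, adjacent, or have a common neighbour (a nontrivial class c^G).
  Dist≤2 : Carrier → Carrier → Set (c ⊔ ℓ)
  Dist≤2 a b = Conj a b ⊎ Adj a b ⊎ ∃ λ d → ¬ (d ≈ ε) × Adj a d × Adj d b

{-# OPTIONS --safe #-}
-- Since ⟨x, a⟩ and ⟨x, b⟩ are solvable, x^G is equal or adjacent to both a^G
-- and b^G.  If two of the classes a^G, b^G, x^G coincide, then a^G and b^G are
-- equal or adjacent; otherwise x^G is a common neighbour.  Only this case
-- distinction on conjugacy is classical, which is why the conclusion is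
-- double negated.
module Submission where

open import Defs
open import Algebra.Bundles using (Group)
open import Data.Nat using (zero; suc)
open import Data.Product using (∃; _×_; _,_)
open import Data.Sum using (inj₁; inj₂; swap)
open import Level using (Level)
open import Relation.Nullary using (¬_)

module SolvableConjugacyGraph {c ℓ : Level} (G : Group c ℓ) where
  open Group G
  open GroupDefs G
  open import Algebra.Properties.Group G
  open import Relation.Binary.Reasoning.Setoid setoid

  Gen-map : ∀ {p q} {P : Carrier → Set p} {Q : Carrier → Set q} →
            (∀ {z} → P z → Q z) → ∀ {z} → Gen P z → Gen Q z
  Gen-map f (gen p)    = gen (f p)
  Gen-map f one        = one
  Gen-map f (inv g)    = inv (Gen-map f g)
  Gen-map f (mul g h)  = mul (Gen-map f g) (Gen-map f h)
  Gen-map f (resp e g) = resp e (Gen-map f g)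

  Derived-swap : ∀ x y n {z} → Derived x y n z → Derived y x n z
  Derived-swap x y zero    = Gen-map swap
  Derived-swap x y (suc n) = Gen-map λ where
    (a , b , da , db , z≈[a,b]) →
      a , b , Derived-swap x y n da , Derived-swap x y n db , z≈[a,b]

  SolvablePair-sym : ∀ {x y} → SolvablePair x y → SolvablePair y x
  SolvablePair-sym {x} {y} (n , trivial) =
    n , λ z d → trivial z (Derived-swap y x n d)

  Conj-refl : ∀ y → Conj y y
  Conj-refl y = ε , sym (begin
    ε ∙ y ∙ ε ⁻¹  ≈⟨ ∙-cong (identityˡ y) ε⁻¹≈ε ⟩
    y ∙ ε         ≈⟨ identityʳ y ⟩
    y             ∎)

  Conj-sym : ∀ {x y} → Conj x y → Conj y x
  Conj-sym {x} {y} (g , y≈gxg⁻¹) = g ⁻¹ , sym (begin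
    g ⁻¹ ∙ y ∙ g ⁻¹ ⁻¹         ≈⟨ ∙-cong (∙-congˡ y≈gxg⁻¹) (⁻¹-involutive g) ⟩
    g ⁻¹ ∙ (g ∙ x ∙ g ⁻¹) ∙ g  ≈⟨ ∙-congʳ (assoc (g ⁻¹) (g ∙ x) (g ⁻¹)) ⟨
    ((g \\ (g ∙ x)) // g) ∙ g  ≈⟨ //-rightDividesˡ g (g \\ (g ∙ x)) ⟩
    g \\ (g ∙ x)               ≈⟨ \\-leftDividesʳ g x ⟩
    x                          ∎)

  Adj-intro : ∀ {a b a' b'} → Conj a a' → Conj b b' → SolvablePair a' b' →
              ¬ Conj a b → Adj a b
  Adj-intro a~a' b~b' solvable a≁b = a≁b , _ , _ , a~a' , b~b' , solvable

  Dist≤2-via-SolG : ∀ {x a b} → ¬ (x ≈ ε) → InSolG x a → InSolG x b →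
                    ¬ ¬ Dist≤2 a b
  Dist≤2-via-SolG {x} {a} {b} x≉ε xa xb ¬dist =
    ¬dist (inj₂ (inj₂ (x , x≉ε ,
      Adj-intro (Conj-refl a) (Conj-refl x) (SolvablePair-sym xa) a≁x ,
      Adj-intro (Conj-refl x) (Conj-refl b) xb x≁b)))
    where
    a≁b : ¬ Conj a b
    a≁b a~b = ¬dist (inj₁ a~b)

    a≁x : ¬ Conj a x
    a≁x a~x = ¬dist (inj₂ (inj₁ (Adj-intro a~x (Conj-refl b) xb a≁b)))

    x≁b : ¬ Conj x b
    x≁b x~b = ¬dist (inj₂ (inj₁
      (Adj-intro (Conj-refl a) (Conj-sym x~b) (SolvablePair-sym xa) a≁b)))

mainTheorem4 : ∀ {c ℓ} (G : Group c ℓ) →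
    let open Group G
        open GroupDefs G
    in (∀ x a b → ¬ (x ≈ ε) → InSolG x a → InSolG x b → ¬ (a ≈ ε) → ¬ (b ≈ ε) →
          ¬ ¬ Dist≤2 a b)
       × ((∃ λ x → ¬ (x ≈ ε) × InSol x) →
          ∀ a b → ¬ (a ≈ ε) → ¬ (b ≈ ε) → ¬ ¬ Dist≤2 a b)
-- Nontriviality of a and b only makes a^G and b^G vertices; Dist≤2 never uses it.
mainTheorem4 G =
  (λ x a b x≉ε xa xb _ _ → Dist≤2-via-SolG x≉ε xa xb) ,
  (λ (x , x≉ε , x∈Sol) a b _ _ → Dist≤2-via-SolG x≉ε (x∈Sol a) (x∈Sol b))
  where open SolvableConjugacyGraph G
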